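{- Let $G_{\mathbf{b}_1,\ldots,\mathbf{b}_d}=\{(f_{\mathbf{a}_1},\ldots,f_{\mathbf{a}_d}):\mathbf{a}_i\in\mathbb{F}_q^{n+1}\}$, an additive group isomorphic to $\mathbb{F}_q^{d(n+1)}$, and let $z=\sum_{(f_1,\ldots,f_d)\in G_{\mathbf{b}_1,\ldots,\mathbf{b}_d}}c_{(f_1,\ldots,f_d)}x_{(f_1,\ldots,f_d)}\in\mathbb{C}[G_{\mathbf{b}_1,\ldots,\mathbf{b}_d}]$ where $c_{(f_1,\ldots,f_d)}=|\{\mathbf{u}\in\mathbb{F}_q^n: f_i(\mathbf{u})=0\ \forall\,1\le i\le d\}|$. Then the matrix of $\phi_z$ with respect to the standard basis $\{x_{(f_1,\ldots,f_d)}\}$ is $\mathbf{T}\mathbf{T}^*$ (with $(f_{\mathbf{a}_1},\ldots,f_{\mathbf{a}_d})$ identified with the row index $(\mathbf{a}_1,\ldots,\mathbf{a}_d)$ of $\mathbf{T}$).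
   Context: Setting: $q$ a prime power, $n,d$ positive integers; $h_1,\ldots,h_d\in\mathbb{F}_q[x_1,\ldots,x_n]$ fixed of total degree at most $q-1$; $\mathbf{b}_i=(b_{i,1},\ldots,b_{i,n})\in(\mathbb{Z}^+)^n$ fixed with $\gcd(b_{i,j},q-1)=1$; $f_{\mathbf{a}_i}(x)=\sum_{j=1}^n a_{i,j}x_j^{b_{i,j}}+a_{i,n+1}$ for $\mathbf{a}_i\in\mathbb{F}_q^{n+1}$; $V_{\mathbf{a}_1,\ldots,\mathbf{a}_d}=\{x\in\mathbb{F}_q^{n+d}: x_{n+i}=h_i(x_1,\ldots,x_n)+f_{\mathbf{a}_i}(x_1,\ldots,x_n)\ \forall i\}$. $\mathbf{T}$ is the $q^{d(n+1)}\times q^{n+d}$ 0/1 incidence matrix (rows: tuples $(\mathbf{a}_1,\ldots,\mathbf{a}_d)$, columns: points, entry $1$ iff point in variety). For an abelian group $H$, $\mathbb{C}[H]$ consists of formal sums $\sum_{h}c_hx_h$ with product $(\sum c_hx_h)(\sum\tilde c_hx_h)=\sum_h(\sum_{h'}c_{h-h'}\tilde c_{h'})x_h$, and $\phi_z(g)=z\cdot g$; the matrix of $\phi_z$ has $(h,h')$ entry equal to the coefficient of $x_h$ in $\phi_z(x_{h'})$. -}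

module Defs where

open import Level using (Level; 0ℓ)
open import Data.Nat using (ℕ; zero; suc; _≤_; _∸_; _^_) renaming (_+_ to _+ℕ_; _*_ to _*ℕ_)
open import Data.Nat.Primality using (Prime)
open import Data.Fin using (Fin; zero; suc; fromℕ; inject₁; _↑ˡ_; _↑ʳ_)
open import Data.Fin.Properties using (all?)
open import Data.List using (List; []; _∷_; map; concatMap; length; filter)
open import Data.List.Membership.Propositional using (_∈_)
open import Data.List.Relation.Unary.All using (All)
open import Data.Product using (Σ; _×_; _,_; proj₁; proj₂)
open import Data.List.Relation.Unary.Unique.Propositional using (Unique)
open import Relation.Binary.PropositionalEquality using (_≡_; _≢_)
open import Relation.Binary.Definitions using (DecidableEquality)
open import Relation.Nullary using (Dec; yes; no; ¬_)
open import Relation.Unary using (Decidable)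
open import Algebra.Structures using (IsCommutativeRing)

record FiniteField (q : ℕ) : Set₁ where
  infixl 6 _+_
  infixl 7 _*_
  field
    Carrier : Set
    _+_ _*_ : Carrier → Carrier → Carrier
    -_      : Carrier → Carrier
    0# 1#   : Carrier
    isCommutativeRing : IsCommutativeRing _≡_ _+_ _*_ -_ 0# 1#
    _⁻¹     : Carrier → Carrier
    ⁻¹-inverse : ∀ x → x ≢ 0# → x * (x ⁻¹) ≡ 1#
    0≢1     : 0# ≢ 1#
    _≟_     : DecidableEquality Carrier
    elements : List Carrier
    complete : ∀ x → x ∈ elements
    unique   : Unique elements
    size     : length elements ≡ q

  _^ᶠ_ : Carrier → ℕ → Carrier
  x ^ᶠ zero  = 1#
  x ^ᶠ suc k = x * (x ^ᶠ k)

IsPrimePower : ℕ → Set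
IsPrimePower q = Σ ℕ λ p → Σ ℕ λ k → Prime p × (1 ≤ k) × (q ≡ p ^ k)

allFuns : {A : Set} → List A → (m : ℕ) → List (Fin m → A)
allFuns xs zero    = (λ ()) ∷ []
allFuns xs (suc m) = concatMap (λ x → map (λ f → λ { zero → x ; (suc i) → f i }) (allFuns xs m)) xs

sumL : {A : Set} → List A → (A → ℕ) → ℕ
sumL []       g = 0
sumL (x ∷ xs) g = g x +ℕ sumL xs g

sumFin : (m : ℕ) → (Fin m → ℕ) → ℕ
sumFin zero    e = 0
sumFin (suc m) e = e zero +ℕ sumFin m (λ i → e (suc i))

count : {A : Set} {P : A → Set} → Decidable P → List A → ℕ
count P? xs = length (filter P? xs)

module Setup {q : ℕ} (𝔽 : FiniteField q) where
  open FiniteField 𝔽 public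

  Vecᶠ : ℕ → Set
  Vecᶠ m = Fin m → Carrier

  allVecs : (m : ℕ) → List (Vecᶠ m)
  allVecs m = allFuns elements m

  Σᶠ : (m : ℕ) → (Vecᶠ m → ℕ) → ℕ
  Σᶠ m g = sumL (allVecs m) g

  -- multivariate polynomials over 𝔽_q in n variables: lists of monomials
  -- (coefficient, exponent vector)
  Poly : ℕ → Set
  Poly n = List (Carrier × (Fin n → ℕ))

  evalMono : {n : ℕ} → (Fin n → ℕ) → Vecᶠ n → Carrier
  evalMono {zero}  e u = 1#
  evalMono {suc n} e u = (u zero ^ᶠ e zero) * evalMono (λ i → e (suc i)) (λ i → u (suc i))

  eval : {n : ℕ} → Poly n → Vecᶠ n → Carrier
  eval []             u = 0#
  eval ((c , e) ∷ ms) u = c * evalMono e u + eval ms u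

  TotDeg≤ : {n : ℕ} → Poly n → ℕ → Set
  TotDeg≤ {n} h D = All (λ m → proj₁ m ≢ 0# → sumFin n (proj₂ m) ≤ D) h

  -- f_a(x) = Σ_j a_j x_j^{b_j} + a_{n+1}, with a : 𝔽_q^{n+1} (index fromℕ n is a_{n+1})
  fpoly : {n : ℕ} → (Fin n → ℕ) → Vecᶠ (suc n) → Vecᶠ n → Carrier
  fpoly {zero}  b a x = a zero
  fpoly {suc n} b a x =
    a zero * (x zero ^ᶠ b zero) + fpoly (λ j → b (suc j)) (λ j → a (suc j)) (λ j → x (suc j))

  -- the index group H = (𝔽_q^{n+1})^d ≅ G_{b_1..b_d}, with componentwise addition
  Grp : ℕ → ℕ → Set
  Grp n d = Fin d → Vecᶠ (suc n)

  _-ᴳ_ : {n d : ℕ} → Grp n d → Grp n d → Grp n d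
  (g -ᴳ g') i j = g i j + (- g' i j)

  allGrp : (n d : ℕ) → List (Grp n d)
  allGrp n d = allFuns (allVecs (suc n)) d

  ΣG : (n d : ℕ) → (Grp n d → ℕ) → ℕ
  ΣG n d g = sumL (allGrp n d) g

  _≟ᴳ_ : {n d : ℕ} (g g' : Grp n d) → Dec (∀ i j → g i j ≡ g' i j)
  g ≟ᴳ g' = all? (λ i → all? (λ j → g i j ≟ g' i j))

  -- group algebra ℂ[H] (integer coefficients suffice here)
  GrpAlg : ℕ → ℕ → Set
  GrpAlg n d = Grp n d → ℕ

  basis : {n d : ℕ} → Grp n d → GrpAlg n d
  basis h k with k ≟ᴳ h
  ... | yes _ = 1
  ... | no  _ = 0

  _⋆_ : {n d : ℕ} → GrpAlg n d → GrpAlg n d → GrpAlg n d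
  _⋆_ {n} {d} c c̃ h = ΣG n d (λ h' → c (h -ᴳ h') *ℕ c̃ h')

  φ : {n d : ℕ} → GrpAlg n d → GrpAlg n d → GrpAlg n d
  φ z g = z ⋆ g

  matφ : {n d : ℕ} → GrpAlg n d → Grp n d → Grp n d → ℕ
  matφ z h h' = φ z (basis h') h

  module Variety {n d : ℕ} (h : Fin d → Poly n) (b : Fin d → Fin n → ℕ) where

    allZero? : (a : Grp n d) (u : Vecᶠ n) → Dec (∀ i → fpoly (b i) (a i) u ≡ 0#)
    allZero? a u = all? (λ i → fpoly (b i) (a i) u ≟ 0#)

    cz : GrpAlg n d
    cz a = count (allZero? a) (allVecs n)

    -- points of 𝔽_q^{n+d}: coordinates x_1..x_n are p (j ↑ˡ d), x_{n+i} is p (n ↑ʳ i)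
    xpart : Vecᶠ (n +ℕ d) → Vecᶠ n
    xpart p j = p (j ↑ˡ d)

    inV? : (a : Grp n d) (p : Vecᶠ (n +ℕ d)) →
           Dec (∀ i → p (n ↑ʳ i) ≡ eval (h i) (xpart p) + fpoly (b i) (a i) (xpart p))
    inV? a p = all? (λ i → p (n ↑ʳ i) ≟ (eval (h i) (xpart p) + fpoly (b i) (a i) (xpart p)))

    T : Grp n d → Vecᶠ (n +ℕ d) → ℕ
    T a p with inV? a p
    ... | yes _ = 1
    ... | no  _ = 0

    -- T T^*  (T is a real 0/1 matrix, so T^* is its transpose)
    TT* : Grp n d → Grp n d → ℕ
    TT* a a' = Σᶠ (n +ℕ d) (λ p → T a p *ℕ T a' p)

{-# OPTIONS --safe #-}
module Submission where

-- Both sides equal c(a − a′). On the left, φ_z sends the basis vector x_{a′} to the translate of z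
-- by a′, so the (a, a′) entry is z(a − a′). On the right, V_a is the graph of
-- F_a(u) = (h_i(u) + f_{a_i}(u))_i, so a common point of V_a and V_{a′} is (u, F_a(u)) for some u
-- with F_a(u) = F_{a′}(u); as f_a is linear in a, these u are the common zeros of the f_{a_i − a′_i}.

open import Defs
open import Data.Nat using (ℕ; _≤_; _∸_)
open import Data.Nat.GCD using (gcd)
open import Data.Fin using (Fin)
open import Relation.Binary.PropositionalEquality using (_≡_)

open import Level using (0ℓ)
open import Algebra.Bundles using (CommutativeRing)
open import Data.Nat.Base using (zero; suc) renaming (_+_ to _+ℕ_; _*_ to _*ℕ_)
open import Data.Nat.Properties using (+-assoc; +-identityʳ; *-zeroʳ; *-identityʳ; *-distribˡ-+)
open import Data.Fin.Base using (zero; suc; splitAt; _↑ˡ_; _↑ʳ_)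
open import Data.Fin.Properties using (all?; ∀-cons-⇔)
open import Data.List.Base as List using (List; []; _∷_; map; concatMap; length)
open import Data.List.Properties using (filter-≐)
open import Data.List.Membership.Propositional using (_∈_; _∉_)
open import Data.List.Relation.Unary.All using (lookup)
open import Data.List.Relation.Unary.Any using (here; there)
open import Data.List.Relation.Unary.AllPairs using (_∷_)
open import Data.List.Relation.Unary.Unique.Propositional using (Unique)
open import Data.Product.Base using (_×_; _,_)
open import Data.Sum.Base using (inj₁; inj₂)
open import Data.Vec.Functional as Vector using (_++_)
open import Data.Vec.Functional.Properties using (∷-cong; lookup-++ˡ; lookup-++ʳ; ++-cong)
open import Data.Vec.Functional.Relation.Binary.Pointwise using (Pointwise)
open import Data.Vec.Functional.Relation.Binary.Pointwise.Properties
  using () renaming (decidable to pointwise?)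
open import Function.Bundles using (_⇔_; mk⇔; Equivalence)
open import Relation.Binary.Core using (_Preserves_⟶_)
open import Relation.Binary.Definitions using (DecidableEquality)
open import Relation.Binary.PropositionalEquality
  using (refl; sym; trans; cong; cong₂; subst; _≗_; module ≡-Reasoning)
open import Relation.Nullary.Decidable using (Dec; yes; no; _×-dec_)
open import Relation.Nullary.Negation using (contradiction)

open ≡-Reasoning

𝟙 : {P : Set} → Dec P → ℕ
𝟙 (yes _) = 1
𝟙 (no _)  = 0

module _ {P Q : Set} where

  𝟙-⇔ : P ⇔ Q → (p : Dec P) (q : Dec Q) → 𝟙 p ≡ 𝟙 q
  𝟙-⇔ P⇔Q (yes _)  (yes _)  = refl
  𝟙-⇔ P⇔Q (yes p)  (no ¬q)  = contradiction (Equivalence.to P⇔Q p) ¬q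
  𝟙-⇔ P⇔Q (no ¬p)  (yes q)  = contradiction (Equivalence.from P⇔Q q) ¬p
  𝟙-⇔ P⇔Q (no _)   (no _)   = refl

  𝟙-×-dec : (p : Dec P) (q : Dec Q) → 𝟙 (p ×-dec q) ≡ 𝟙 p *ℕ 𝟙 q
  𝟙-×-dec (yes _) (yes _) = refl
  𝟙-×-dec (yes _) (no _)  = refl
  𝟙-×-dec (no _)  _       = refl

𝟙-all?-suc : ∀ {m} {P : Fin (suc m) → Set} (P? : ∀ i → Dec (P i)) →
             𝟙 (all? P?) ≡ 𝟙 (P? zero) *ℕ 𝟙 (all? (λ i → P? (suc i)))
𝟙-all?-suc P? = trans (sym (𝟙-⇔ ∀-cons-⇔ (P? zero ×-dec all? (λ i → P? (suc i))) (all? P?)))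
                      (𝟙-×-dec (P? zero) (all? (λ i → P? (suc i))))

module _ {A : Set} where

  sumL-cong : ∀ xs {f g : A → ℕ} → f ≗ g → sumL xs f ≡ sumL xs g
  sumL-cong []       f≗g = refl
  sumL-cong (x ∷ xs) f≗g = cong₂ _+ℕ_ (f≗g x) (sumL-cong xs f≗g)

  sumL-++ : ∀ xs ys (f : A → ℕ) → sumL (xs List.++ ys) f ≡ sumL xs f +ℕ sumL ys f
  sumL-++ []       ys f = refl
  sumL-++ (x ∷ xs) ys f = trans (cong (f x +ℕ_) (sumL-++ xs ys f)) (sym (+-assoc (f x) _ _))

  sumL-*ˡ : ∀ xs c (f : A → ℕ) → sumL xs (λ x → c *ℕ f x) ≡ c *ℕ sumL xs f
  sumL-*ˡ []       c f = sym (*-zeroʳ c)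
  sumL-*ˡ (x ∷ xs) c f = trans (cong (c *ℕ f x +ℕ_) (sumL-*ˡ xs c f)) (sym (*-distribˡ-+ c (f x) _))

  count≡sumL-𝟙 : ∀ {P : A → Set} (P? : ∀ x → Dec (P x)) xs →
                 count P? xs ≡ sumL xs (λ x → 𝟙 (P? x))
  count≡sumL-𝟙 P? []       = refl
  count≡sumL-𝟙 P? (x ∷ xs) with P? x
  ... | yes _ = cong suc (count≡sumL-𝟙 P? xs)
  ... | no _  = count≡sumL-𝟙 P? xs

module _ {A B : Set} where

  sumL-map : ∀ (g : A → B) xs (f : B → ℕ) → sumL (map g xs) f ≡ sumL xs (λ x → f (g x))
  sumL-map g []       f = refl
  sumL-map g (x ∷ xs) f = cong (f (g x) +ℕ_) (sumL-map g xs f)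

  sumL-concatMap : ∀ xs (g : A → List B) (f : B → ℕ) →
                   sumL (concatMap g xs) f ≡ sumL xs (λ x → sumL (g x) f)
  sumL-concatMap []       g f = refl
  sumL-concatMap (x ∷ xs) g f =
    trans (sumL-++ (g x) (concatMap g xs) f) (cong (sumL (g x) f +ℕ_) (sumL-concatMap xs g f))

-- R plays the role of equality on A: functions Fin m → A can only be compared pointwise.
module _ {A : Set} {R : A → A → Set} (R? : ∀ x y → Dec (R x y)) where

  Enumerates : List A → Set
  Enumerates xs = ∀ x → sumL xs (λ y → 𝟙 (R? y x)) ≡ 1

  sumL-δ : ∀ {xs} → Enumerates xs → (F : A → ℕ) → F Preserves R ⟶ _≡_ →
           ∀ x → sumL xs (λ y → F y *ℕ 𝟙 (R? y x)) ≡ F x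
  sumL-δ {xs} enum F F-resp x = begin
    sumL xs (λ y → F y *ℕ 𝟙 (R? y x))  ≡⟨ sumL-cong xs move-factor ⟩
    sumL xs (λ y → F x *ℕ 𝟙 (R? y x))  ≡⟨ sumL-*ˡ xs (F x) _ ⟩
    F x *ℕ sumL xs (λ y → 𝟙 (R? y x))  ≡⟨ cong (F x *ℕ_) (enum x) ⟩
    F x *ℕ 1                           ≡⟨ *-identityʳ (F x) ⟩
    F x                                ∎
    where
    move-factor : ∀ y → F y *ℕ 𝟙 (R? y x) ≡ F x *ℕ 𝟙 (R? y x)
    move-factor y with R? y x
    ... | yes Ryx = cong (_*ℕ 1) (F-resp Ryx)
    ... | no _    = trans (*-zeroʳ (F y)) (sym (*-zeroʳ (F x)))

module _ {A : Set} (_≟_ : DecidableEquality A) where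

  sumL-𝟙-≟-∉ : ∀ {x} xs → x ∉ xs → sumL xs (λ y → 𝟙 (y ≟ x)) ≡ 0
  sumL-𝟙-≟-∉ {x} []       x∉xs = refl
  sumL-𝟙-≟-∉ {x} (y ∷ ys) x∉xs with y ≟ x
  ... | yes refl = contradiction (here refl) x∉xs
  ... | no _     = sumL-𝟙-≟-∉ ys (λ x∈ys → x∉xs (there x∈ys))

  sumL-𝟙-≟-∈ : ∀ {x xs} → Unique xs → x ∈ xs → sumL xs (λ y → 𝟙 (y ≟ x)) ≡ 1
  sumL-𝟙-≟-∈ {x} {y ∷ ys} (y∉ys ∷ _) (here refl) with y ≟ x
  ... | yes _  = cong suc (sumL-𝟙-≟-∉ ys (λ y∈ys → lookup y∉ys y∈ys refl))
  ... | no y≢y = contradiction refl y≢y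
  sumL-𝟙-≟-∈ {x} {y ∷ ys} (y∉ys ∷ uniq) (there x∈ys) with y ≟ x
  ... | yes refl = contradiction refl (lookup y∉ys x∈ys)
  ... | no _     = sumL-𝟙-≟-∈ uniq x∈ys

  unique-complete⇒enumerates : ∀ {xs} → Unique xs → (∀ x → x ∈ xs) → Enumerates _≟_ xs
  unique-complete⇒enumerates uniq complete x = sumL-𝟙-≟-∈ uniq (complete x)

≗-⇔ : ∀ {A B : Set} {v v' w w' : A → B} → v ≗ v' → w ≗ w' → (v ≗ w) ⇔ (v' ≗ w')
≗-⇔ v≗v' w≗w' = mk⇔ (λ v≗w i → trans (sym (v≗v' i)) (trans (v≗w i) (w≗w' i)))
                    (λ v'≗w' i → trans (v≗v' i) (trans (v'≗w' i) (sym (w≗w' i))))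

∷-++ : ∀ {A : Set} {m k} (x : A) (u : Fin m → A) (w : Fin k → A) →
       x Vector.∷ (u ++ w) ≗ (x Vector.∷ u) ++ w
∷-++ x u w zero = refl
∷-++ {m = m} x u w (suc i) with splitAt m i
... | inj₁ _ = refl
... | inj₂ _ = refl

module _ {A : Set} (xs : List A) where

  -- allFuns conses with its own pattern lambda, which agrees with Vector._∷_ only pointwise.
  sumL-allFuns-suc : ∀ {m} (F : (Fin (suc m) → A) → ℕ) → F Preserves _≗_ ⟶ _≡_ →
    sumL (allFuns xs (suc m)) F ≡ sumL xs (λ x → sumL (allFuns xs m) (λ g → F (x Vector.∷ g)))
  sumL-allFuns-suc {m} F F-cong =
    trans (sumL-concatMap xs _ F)
          (sumL-cong xs (λ x → trans (sumL-map _ (allFuns xs m) F)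
                                     (sumL-cong (allFuns xs m) (λ g → F-cong (∷-cong refl (λ _ → refl))))))

  sumL-allFuns-++ : ∀ m {k} (G : (Fin (m +ℕ k) → A) → ℕ) → G Preserves _≗_ ⟶ _≡_ →
    sumL (allFuns xs (m +ℕ k)) G ≡ sumL (allFuns xs m) (λ u → sumL (allFuns xs k) (λ w → G (u ++ w)))
  sumL-allFuns-++ zero    G G-cong = sym (+-identityʳ _)
  sumL-allFuns-++ (suc m) {k} G G-cong = begin
    sumL (allFuns xs (suc (m +ℕ k))) G
      ≡⟨ sumL-allFuns-suc G G-cong ⟩
    sumL xs (λ x → sumL (allFuns xs (m +ℕ k)) (λ g → G (x Vector.∷ g)))
      ≡⟨ sumL-cong xs (λ x → sumL-allFuns-++ m (λ g → G (x Vector.∷ g))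
                                             (λ e → G-cong (∷-cong refl e))) ⟩
    sumL xs (λ x → sumL (allFuns xs m) (λ u → sumL (allFuns xs k) (λ w → G (x Vector.∷ (u ++ w)))))
      ≡⟨ sumL-cong xs (λ x → sumL-cong (allFuns xs m) (λ u → sumL-cong (allFuns xs k) (λ w →
           G-cong (∷-++ x u w)))) ⟩
    sumL xs (λ x → sumL (allFuns xs m) (λ u → sumL (allFuns xs k) (λ w → G ((x Vector.∷ u) ++ w))))
      ≡⟨ sumL-allFuns-suc (λ u → sumL (allFuns xs k) (λ w → G (u ++ w)))
           (λ e → sumL-cong (allFuns xs k) (λ w → G-cong (++-cong _ _ e (λ _ → refl)))) ⟨
    sumL (allFuns xs (suc m)) (λ u → sumL (allFuns xs k) (λ w → G (u ++ w)))
      ∎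

module _ {A : Set} {R : A → A → Set} (R? : ∀ x y → Dec (R x y)) {xs : List A}
         (enum : Enumerates R? xs) where

  allFuns-enumerates : ∀ m → Enumerates (pointwise? R?) (allFuns xs m)
  allFuns-enumerates zero    f = refl
  allFuns-enumerates (suc m) f = begin
    sumL (allFuns xs (suc m)) (λ g → 𝟙 (pointwise? R? g f))
      ≡⟨ sumL-allFuns-suc xs (λ g → 𝟙 (pointwise? R? g f)) 𝟙-pointwise?-cong ⟩
    sumL xs (λ x → sumL (allFuns xs m) (λ g → 𝟙 (pointwise? R? (x Vector.∷ g) f)))
      ≡⟨ sumL-cong xs (λ x → sumL-cong (allFuns xs m) (λ g →
           𝟙-all?-suc (λ i → R? ((x Vector.∷ g) i) (f i)))) ⟩
    sumL xs (λ x → sumL (allFuns xs m) (λ g → 𝟙 (R? x (f zero)) *ℕ 𝟙 (pointwise? R? g (Vector.tail f))))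
      ≡⟨ sumL-cong xs (λ x → sumL-δ (pointwise? R?) {allFuns xs m} (allFuns-enumerates m)
                                    (λ _ → 𝟙 (R? x (f zero))) (λ _ → refl) (Vector.tail f)) ⟩
    sumL xs (λ x → 𝟙 (R? x (f zero)))
      ≡⟨ enum (f zero) ⟩
    1 ∎
    where
    𝟙-pointwise?-cong : (λ g → 𝟙 (pointwise? R? g f)) Preserves _≗_ ⟶ _≡_
    𝟙-pointwise?-cong g≗g' = 𝟙-⇔ (mk⇔ (λ r i → subst (λ t → R t (f i)) (g≗g' i) (r i))
                                       (λ r i → subst (λ t → R t (f i)) (sym (g≗g' i)) (r i)))
                                  (pointwise? R? _ f) (pointwise? R? _ f)

module _ {q : ℕ} (𝔽 : FiniteField q) where
  open Setup 𝔽

  private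
    ring : CommutativeRing 0ℓ 0ℓ
    ring = record { isCommutativeRing = isCommutativeRing }

  open CommutativeRing ring using (+-abelianGroup; +-group; +-commutativeSemigroup; distribʳ)
  open import Algebra.Properties.Ring (CommutativeRing.ring ring) using (-‿distribˡ-*)
  open import Algebra.Properties.AbelianGroup +-abelianGroup using (⁻¹-∙-comm)
  open import Algebra.Properties.Group +-group using (x∙y⁻¹≈ε⇒x≈y; x≈y⇒x∙y⁻¹≈ε; ∙-cancelˡ)
  open import Algebra.Properties.CommutativeSemigroup +-commutativeSemigroup using (interchange)

  elements-enumerates : Enumerates _≟_ elements
  elements-enumerates = unique-complete⇒enumerates _≟_ unique complete

  allVecs-enumerates : ∀ m → Enumerates (pointwise? _≟_) (allVecs m)
  allVecs-enumerates = allFuns-enumerates _≟_ elements-enumerates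

  allGrp-enumerates : ∀ n d → Enumerates (pointwise? (pointwise? _≟_)) (allGrp n d)
  allGrp-enumerates n d = allFuns-enumerates (pointwise? _≟_) (allVecs-enumerates (suc n)) d

  evalMono-cong : ∀ {n} (e : Fin n → ℕ) {u u' : Vecᶠ n} → u ≗ u' → evalMono e u ≡ evalMono e u'
  evalMono-cong {zero}  e u≗u' = refl
  evalMono-cong {suc n} e u≗u' =
    cong₂ _*_ (cong (_^ᶠ e zero) (u≗u' zero)) (evalMono-cong (Vector.tail e) (λ i → u≗u' (suc i)))

  eval-cong : ∀ {n} (p : Poly n) {u u' : Vecᶠ n} → u ≗ u' → eval p u ≡ eval p u'
  eval-cong []             u≗u' = refl
  eval-cong ((c , e) ∷ ms) u≗u' = cong₂ _+_ (cong (c *_) (evalMono-cong e u≗u')) (eval-cong ms u≗u')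

  fpoly-cong : ∀ {n} (b : Fin n → ℕ) {a a' : Vecᶠ (suc n)} {x x' : Vecᶠ n} →
               a ≗ a' → x ≗ x' → fpoly b a x ≡ fpoly b a' x'
  fpoly-cong {zero}  b a≗a' x≗x' = a≗a' zero
  fpoly-cong {suc n} b a≗a' x≗x' =
    cong₂ _+_ (cong₂ _*_ (a≗a' zero) (cong (_^ᶠ b zero) (x≗x' zero)))
              (fpoly-cong (Vector.tail b) (λ j → a≗a' (suc j)) (λ j → x≗x' (suc j)))

  fpoly-sub : ∀ {n} (b : Fin n → ℕ) (a a' : Vecᶠ (suc n)) x →
              fpoly b (λ j → a j + - a' j) x ≡ fpoly b a x + - fpoly b a' x
  fpoly-sub {zero}  b a a' x = refl
  fpoly-sub {suc n} b a a' x = begin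
    (a zero + - a' zero) * X + fpoly b⁺ (λ j → a⁺ j + - a'⁺ j) x⁺
      ≡⟨ cong₂ _+_ (distribʳ X (a zero) (- a' zero)) (fpoly-sub b⁺ a⁺ a'⁺ x⁺) ⟩
    (a zero * X + - a' zero * X) + (Y + - Y')
      ≡⟨ cong (λ t → (a zero * X + t) + (Y + - Y')) (sym (-‿distribˡ-* (a' zero) X)) ⟩
    (a zero * X + - (a' zero * X)) + (Y + - Y')
      ≡⟨ interchange (a zero * X) (- (a' zero * X)) Y (- Y') ⟩
    (a zero * X + Y) + (- (a' zero * X) + - Y')
      ≡⟨ cong ((a zero * X + Y) +_) (⁻¹-∙-comm (a' zero * X) Y') ⟩
    (a zero * X + Y) + - (a' zero * X + Y')
      ∎
    where
    b⁺ : Fin n → ℕ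
    b⁺ = Vector.tail b
    a⁺ a'⁺ : Vecᶠ (suc n)
    a⁺  = Vector.tail a
    a'⁺ = Vector.tail a'
    x⁺ : Vecᶠ n
    x⁺ = Vector.tail x
    X Y Y' : Carrier
    X  = x zero ^ᶠ b zero
    Y  = fpoly b⁺ a⁺ x⁺
    Y' = fpoly b⁺ a'⁺ x⁺

  matφ≡translate : ∀ {n d} (z : GrpAlg n d) → z Preserves Pointwise _≗_ ⟶ _≡_ →
                   ∀ a a' → matφ z a a' ≡ z (a -ᴳ a')
  matφ≡translate {n} {d} z z-cong a a' = begin
    ΣG n d (λ g → z (a -ᴳ g) *ℕ basis a' g)
      ≡⟨ sumL-cong (allGrp n d) (λ g → cong (z (a -ᴳ g) *ℕ_) (basis≡𝟙 g)) ⟩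
    ΣG n d (λ g → z (a -ᴳ g) *ℕ 𝟙 (g ≟ᴳ a'))
      ≡⟨ sumL-δ (pointwise? (pointwise? _≟_)) {allGrp n d} (allGrp-enumerates n d)
                (λ g → z (a -ᴳ g)) (λ g≗g' → z-cong (λ i j → cong (λ t → a i j + - t) (g≗g' i j)))
                a' ⟩
    z (a -ᴳ a')
      ∎
    where
    basis≡𝟙 : ∀ g → basis a' g ≡ 𝟙 (g ≟ᴳ a')
    basis≡𝟙 g with g ≟ᴳ a'
    ... | yes _ = refl
    ... | no _  = refl

  module _ {n d : ℕ} (h : Fin d → Poly n) (b : Fin d → Fin n → ℕ) where
    open Variety h b

    CommonZero : Grp n d → Vecᶠ n → Set
    CommonZero g u = ∀ i → fpoly (b i) (g i) u ≡ 0#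

    cz-cong : cz Preserves Pointwise _≗_ ⟶ _≡_
    cz-cong {g} {g'} g≗g' =
      cong length (filter-≐ (allZero? g) (allZero? g') (g⊆g' , g'⊆g) (allVecs n))
      where
      g⊆g' : ∀ {u} → CommonZero g u → CommonZero g' u
      g⊆g' z i = trans (fpoly-cong (b i) (λ j → sym (g≗g' i j)) (λ _ → refl)) (z i)
      g'⊆g : ∀ {u} → CommonZero g' u → CommonZero g u
      g'⊆g z i = trans (fpoly-cong (b i) (g≗g' i) (λ _ → refl)) (z i)

    -- V_a is the graph of F a : 𝔽_q^n → 𝔽_q^d.
    F : Grp n d → Vecᶠ n → Vecᶠ d
    F a u i = eval (h i) u + fpoly (b i) (a i) u

    F-cong : ∀ a {u u'} → u ≗ u' → F a u ≗ F a u'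
    F-cong a u≗u' i = cong₂ _+_ (eval-cong (h i) u≗u') (fpoly-cong (b i) (λ _ → refl) u≗u')

    F≗F⇔CommonZero : ∀ a a' u → (F a u ≗ F a' u) ⇔ CommonZero (a -ᴳ a') u
    F≗F⇔CommonZero a a' u = mk⇔
      (λ F≗F i → trans (fpoly-sub (b i) (a i) (a' i) u)
                       (x≈y⇒x∙y⁻¹≈ε (∙-cancelˡ (eval (h i) u) _ _ (F≗F i))))
      (λ z i → cong (eval (h i) u +_)
                    (x∙y⁻¹≈ε⇒x≈y _ _ (trans (sym (fpoly-sub (b i) (a i) (a' i) u)) (z i))))

    T≡𝟙 : ∀ a p → T a p ≡ 𝟙 (inV? a p)
    T≡𝟙 a p with inV? a p
    ... | yes _ = refl
    ... | no _  = refl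

    T-cong : ∀ a → T a Preserves _≗_ ⟶ _≡_
    T-cong a {p} {p'} p≗p' = begin
      T a p          ≡⟨ T≡𝟙 a p ⟩
      𝟙 (inV? a p)   ≡⟨ 𝟙-⇔ (≗-⇔ (λ i → p≗p' (n ↑ʳ i)) (F-cong a (λ j → p≗p' (j ↑ˡ d))))
                            _ _ ⟩
      𝟙 (inV? a p')  ≡⟨ T≡𝟙 a p' ⟨
      T a p'         ∎

    T-++ : ∀ a u w → T a (u ++ w) ≡ 𝟙 (pointwise? _≟_ w (F a u))
    T-++ a u w =
      trans (T≡𝟙 a (u ++ w)) (𝟙-⇔ (≗-⇔ (lookup-++ʳ u w) (F-cong a (lookup-++ˡ u w))) _ _)

    TT*-fibre : ∀ a a' u →
      sumL (allVecs d) (λ w → T a (u ++ w) *ℕ T a' (u ++ w)) ≡ 𝟙 (allZero? (a -ᴳ a') u)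
    TT*-fibre a a' u = begin
      sumL (allVecs d) (λ w → T a (u ++ w) *ℕ T a' (u ++ w))
        ≡⟨ sumL-cong (allVecs d) (λ w → cong₂ _*ℕ_ (T-++ a u w) (T-++ a' u w)) ⟩
      sumL (allVecs d) (λ w → 𝟙 (on-V w) *ℕ 𝟙 (on-V' w))
        ≡⟨ sumL-cong (allVecs d) on-both ⟩
      sumL (allVecs d) (λ w → 𝟙 (allZero? (a -ᴳ a') u) *ℕ 𝟙 (on-V w))
        ≡⟨ sumL-δ (pointwise? _≟_) {allVecs d} (allVecs-enumerates d)
                  (λ _ → 𝟙 (allZero? (a -ᴳ a') u)) (λ _ → refl) (F a u) ⟩
      𝟙 (allZero? (a -ᴳ a') u)
        ∎
      where
      on-V : ∀ w → Dec (w ≗ F a u)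
      on-V w = pointwise? _≟_ w (F a u)
      on-V' : ∀ w → Dec (w ≗ F a' u)
      on-V' w = pointwise? _≟_ w (F a' u)
      on-both : ∀ w → 𝟙 (on-V w) *ℕ 𝟙 (on-V' w) ≡ 𝟙 (allZero? (a -ᴳ a') u) *ℕ 𝟙 (on-V w)
      on-both w = begin
        𝟙 (on-V w) *ℕ 𝟙 (on-V' w)               ≡⟨ 𝟙-×-dec (on-V w) (on-V' w) ⟨
        𝟙 (on-V w ×-dec on-V' w)                ≡⟨ 𝟙-⇔ (mk⇔ to from) _ _ ⟩
        𝟙 (allZero? (a -ᴳ a') u ×-dec on-V w)   ≡⟨ 𝟙-×-dec (allZero? (a -ᴳ a') u) (on-V w) ⟩
        𝟙 (allZero? (a -ᴳ a') u) *ℕ 𝟙 (on-V w)  ∎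
        where
        open Equivalence (F≗F⇔CommonZero a a' u) renaming (to to F≗F⇒zero; from to zero⇒F≗F)
        to : w ≗ F a u × w ≗ F a' u → CommonZero (a -ᴳ a') u × w ≗ F a u
        to (w≗F , w≗F') = F≗F⇒zero (λ i → trans (sym (w≗F i)) (w≗F' i)) , w≗F
        from : CommonZero (a -ᴳ a') u × w ≗ F a u → w ≗ F a u × w ≗ F a' u
        from (z , w≗F) = w≗F , λ i → trans (w≗F i) (zero⇒F≗F z i)

    TT*≡cz : ∀ a a' → TT* a a' ≡ cz (a -ᴳ a')
    TT*≡cz a a' = begin
      TT* a a'
        ≡⟨ sumL-allFuns-++ elements n (λ p → T a p *ℕ T a' p)
                           (λ p≗p' → cong₂ _*ℕ_ (T-cong a p≗p') (T-cong a' p≗p')) ⟩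
      sumL (allVecs n) (λ u → sumL (allVecs d) (λ w → T a (u ++ w) *ℕ T a' (u ++ w)))
        ≡⟨ sumL-cong (allVecs n) (TT*-fibre a a') ⟩
      sumL (allVecs n) (λ u → 𝟙 (allZero? (a -ᴳ a') u))
        ≡⟨ count≡sumL-𝟙 (allZero? (a -ᴳ a')) (allVecs n) ⟨
      cz (a -ᴳ a')
        ∎

lemma3p7 : (q : ℕ) → IsPrimePower q → (𝔽 : FiniteField q) →
    (n d : ℕ) → 1 ≤ n → 1 ≤ d →
    (h : Fin d → Setup.Poly 𝔽 n) → (∀ i → Setup.TotDeg≤ 𝔽 (h i) (q ∸ 1)) →
    (b : Fin d → Fin n → ℕ) → (∀ i j → 1 ≤ b i j) → (∀ i j → gcd (b i j) (q ∸ 1) ≡ 1) →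
    ∀ (a a' : Setup.Grp 𝔽 n d) →
      Setup.matφ 𝔽 (Setup.Variety.cz 𝔽 h b) a a' ≡ Setup.Variety.TT* 𝔽 h b a a'
lemma3p7 q _ 𝔽 n d _ _ h _ b _ _ a a' = begin
  Setup.matφ 𝔽 (Setup.Variety.cz 𝔽 h b) a a'  ≡⟨ matφ≡translate 𝔽 _ (cz-cong 𝔽 h b) a a' ⟩
  Setup.Variety.cz 𝔽 h b (Setup._-ᴳ_ 𝔽 a a')  ≡⟨ TT*≡cz 𝔽 h b a a' ⟨
  Setup.Variety.TT* 𝔽 h b a a'                 ∎
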